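{- A sequent $\Gamma\vdash B$ is derivable in $\mathcal{S}$ if and only if $\Gamma^\ast\vdash B^\ast$ is derivable in $\mathcal{IL}$.
   Context: Formulae are built from an infinite set of propositional letters and a constant $I$ using binary connectives $\otimes$ and $\to$. System $\mathcal{S}$: sequents $\Gamma\vdash A$, $\Gamma$ a finite possibly empty sequence of formulae. Axioms $A\vdash A$ and $\vdash I$. Rules: weakening: from $\Gamma\vdash A$ infer $I,\Gamma\vdash A$; interchange: from $\Gamma,A,B,\Delta\vdash C$ infer $\Gamma,B,A,\Delta\vdash C$; cut: from $\Gamma\vdash A$ and $\Delta,A,\Theta\vdash B$ infer $\Delta,\Gamma,\Theta\vdash B$; $(\otimes\vdash)$: from $\Gamma,A,B,\Delta\vdash C$ infer $\Gamma,A\otimes B,\Delta\vdash C$; $(\vdash\otimes)$: from $\Gamma\vdash A$ and $\Delta\vdash B$ infer $\Gamma,\Delta\vdash A\otimes B$; $(\to\vdash)$: from $\Gamma\vdash A$ and $B,\Delta\vdash C$ infer $\Gamma,A\to B,\Delta\vdash C$; $(\vdash\to)$: from $A,\Gamma\vdash B$ infer $\Gamma\vdash A\to B$. An $\alpha$-formula is a formula considered up to strict associativity of $\otimes$ and strict unitality of $I$ ($A\otimes(B\otimes C)=(A\otimes B)\otimes C$, $A\otimes I=I\otimes A=A$, also inside subformulae). System $\mathcal{IL}$: sequents $G\vdash A$ with $G,A$ $\alpha$-formulae. Axioms $A\vdash A$. Rules (letters denote $\alpha$-formulae, possibly $I$, $\otimes$ the operation with unit $I$): interchange: from $G\otimes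 A\otimes B\otimes E\vdash D$ infer $G\otimes B\otimes A\otimes E\vdash D$; cut: from $C\vdash A$ and $G\otimes A\otimes E\vdash D$ infer $G\otimes C\otimes E\vdash D$; $(\to\vdash)$: from $C\vdash A$ and $B\otimes G\vdash D$ infer $C\otimes(A\to B)\otimes G\vdash D$; $(\vdash\to)$: from $A\otimes G\vdash C$ infer $G\vdash A\to C$; $(\otimes\vdash\otimes)$: from $A\vdash C$ and $B\vdash E$ infer $A\otimes B\vdash C\otimes E$. For a formula $A$, $A^\ast$ is the $\alpha$-formula obtained by deleting superfluous brackets and $I$'s (i.e. $A$ read as an $\alpha$-formula); for a sequence $\Gamma=A_1,\dots,A_n$, $\Gamma^\ast=(\dots(A_1\otimes A_2)\otimes\dots\otimes A_n)^\ast$, and $\Gamma^\ast=I$ if $\Gamma$ is empty. -}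

module Defs where

open import Data.Nat using (ℕ)
open import Data.List using (List; []; _∷_; _++_; [_])

infixr 6 _⊗_
infixr 5 _⇒_

data Formula : Set where
  var : ℕ → Formula
  I   : Formula
  _⊗_ : Formula → Formula → Formula
  _⇒_ : Formula → Formula → Formula

infix 3 _⊢S_

data _⊢S_ : List Formula → Formula → Set where
  ax     : ∀ {A} → [ A ] ⊢S A
  axI    : [] ⊢S I
  weak   : ∀ {Γ A} → Γ ⊢S A → (I ∷ Γ) ⊢S A
  exch   : ∀ {Γ A B Δ C} → (Γ ++ A ∷ B ∷ Δ) ⊢S C → (Γ ++ B ∷ A ∷ Δ) ⊢S C
  cut    : ∀ {Γ A Δ Θ B} → Γ ⊢S A → (Δ ++ A ∷ Θ) ⊢S B → (Δ ++ Γ ++ Θ) ⊢S B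
  ⊗L     : ∀ {Γ A B Δ C} → (Γ ++ A ∷ B ∷ Δ) ⊢S C → (Γ ++ (A ⊗ B) ∷ Δ) ⊢S C
  ⊗R     : ∀ {Γ Δ A B} → Γ ⊢S A → Δ ⊢S B → (Γ ++ Δ) ⊢S (A ⊗ B)
  ⇒L     : ∀ {Γ A B Δ C} → Γ ⊢S A → (B ∷ Δ) ⊢S C → (Γ ++ (A ⇒ B) ∷ Δ) ⊢S C
  ⇒R     : ∀ {A Γ B} → (A ∷ Γ) ⊢S B → Γ ⊢S (A ⇒ B)

-- α-formulae: formulae up to strict associativity of ⊗ and strict
-- unitality of I (also inside subformulae).  Since there are no
-- quotient types, we use the canonical representation: an α-formula is
-- a finite word (list) of "factors" (the free monoid on factors), the
-- empty word being I and ⊗ being concatenation; a factor is either a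
-- propositional letter or an implication between α-formulae.

mutual
  data Factor : Set where
    fvar : ℕ → Factor
    fimp : AFormula → AFormula → Factor

  AFormula : Set
  AFormula = List Factor

Iα : AFormula
Iα = []

infixr 6 _⊗α_
_⊗α_ : AFormula → AFormula → AFormula
_⊗α_ = _++_

infixr 5 _⇒α_
_⇒α_ : AFormula → AFormula → AFormula
A ⇒α B = [ fimp A B ]

infix 3 _⊢IL_

data _⊢IL_ : AFormula → AFormula → Set where
  ax   : ∀ {A} → A ⊢IL A
  exch : ∀ {G A B E D} → (G ⊗α A ⊗α B ⊗α E) ⊢IL D → (G ⊗α B ⊗α A ⊗α E) ⊢IL D
  cut  : ∀ {C A G E D} → C ⊢IL A → (G ⊗α A ⊗α E) ⊢IL D → (G ⊗α C ⊗α E) ⊢IL D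
  ⇒L   : ∀ {C A B G D} → C ⊢IL A → (B ⊗α G) ⊢IL D → (C ⊗α (A ⇒α B) ⊗α G) ⊢IL D
  ⇒R   : ∀ {A G C} → (A ⊗α G) ⊢IL C → G ⊢IL (A ⇒α C)
  ⊗⊗   : ∀ {A B C E} → A ⊢IL C → B ⊢IL E → (A ⊗α B) ⊢IL (C ⊗α E)

_* : Formula → AFormula
var p * = [ fvar p ]
I *     = Iα
(A ⊗ B) * = (A *) ⊗α (B *)
(A ⇒ B) * = (A *) ⇒α (B *)

_*s : List Formula → AFormula
[] *s      = Iα
(A ∷ Γ) *s = (A *) ⊗α (Γ *s)

{-# OPTIONS --safe #-}
-- Forward, each rule of S becomes a rule of IL or disappears: ⊗L and weakening
-- by I are absorbed by the monoid structure of α-formulae.  Backward, an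
-- α-formula G is read back in S either as the context ⟦ G ⟧ of its factors or
-- as the formula ⌜ G ⌝ = f₁ ⊗ (… ⊗ (fₙ ⊗ I)).  Every rule of IL is admissible
-- for the sequents ⟦ G ⟧ ⊢ ⌜ D ⌝, because S is closed under permuting contexts
-- and ⌜ G ⌝ may replace ⟦ G ⟧ on the left.  Finally A and ⌜ A * ⌝ are
-- interderivable in S, which carries Γ ⊢ B back from ⟦ Γ *s ⟧ ⊢ ⌜ B * ⌝.
module Submission where

open import Defs
open import Data.List using (List; []; _∷_; _++_; [_]; map)
open import Data.List.Properties using (++-assoc; ++-identityʳ; map-++)
open import Data.List.Relation.Binary.Permutation.Propositional as ↭
  using (_↭_; ↭-sym)
open import Data.List.Relation.Binary.Permutation.Propositional.Properties
  using (shift; shifts; ++⁺ˡ; map⁺)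
open import Function.Bundles using (_⇔_; mk⇔)
open import Relation.Binary.PropositionalEquality using (_≡_; refl; sym; trans; cong; subst)

*s-++ : ∀ Γ Δ → (Γ ++ Δ) *s ≡ Γ *s ⊗α Δ *s
*s-++ []      Δ = refl
*s-++ (A ∷ Γ) Δ rewrite *s-++ Γ Δ = sym (++-assoc (A *) (Γ *s) (Δ *s))

split-*s : ∀ Γ Δ {D} → (Γ ++ Δ) *s ⊢IL D → Γ *s ⊗α Δ *s ⊢IL D
split-*s Γ Δ = subst (_⊢IL _) (*s-++ Γ Δ)

⊢S⇒⊢IL : ∀ {Γ B} → Γ ⊢S B → Γ *s ⊢IL B *
⊢S⇒⊢IL (ax {A}) rewrite ++-identityʳ (A *) = ax
⊢S⇒⊢IL axI = ax
⊢S⇒⊢IL (weak d) = ⊢S⇒⊢IL d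
⊢S⇒⊢IL (exch {Γ} {A} {B} {Δ} d) rewrite *s-++ Γ (B ∷ A ∷ Δ) =
  exch {G = Γ *s} {A *} {B *} (split-*s Γ _ (⊢S⇒⊢IL d))
⊢S⇒⊢IL (cut {Γ} {A} {Δ} {Θ} d e) rewrite *s-++ Δ (Γ ++ Θ) | *s-++ Γ Θ =
  cut {G = Δ *s} (⊢S⇒⊢IL d) (split-*s Δ _ (⊢S⇒⊢IL e))
⊢S⇒⊢IL (⊗L {Γ} {A} {B} {Δ} d) rewrite *s-++ Γ ((A ⊗ B) ∷ Δ) | ++-assoc (A *) (B *) (Δ *s) =
  split-*s Γ _ (⊢S⇒⊢IL d)
⊢S⇒⊢IL (⊗R {Γ} {Δ} d e) rewrite *s-++ Γ Δ = ⊗⊗ (⊢S⇒⊢IL d) (⊢S⇒⊢IL e)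
⊢S⇒⊢IL (⇒L {Γ} {A} {B} {Δ} d e) rewrite *s-++ Γ ((A ⇒ B) ∷ Δ) =
  ⇒L {G = Δ *s} (⊢S⇒⊢IL d) (⊢S⇒⊢IL e)
⊢S⇒⊢IL (⇒R d) = ⇒R (⊢S⇒⊢IL d)

⊢S-resp-↭ : ∀ {Γ Δ C} → Γ ↭ Δ → Γ ⊢S C → Δ ⊢S C
⊢S-resp-↭ = under []
  where
  under : ∀ P {Γ Δ C} → Γ ↭ Δ → P ++ Γ ⊢S C → P ++ Δ ⊢S C
  under P ↭.refl d = d
  under P (↭.prep A p) d =
    subst (_⊢S _) (++-assoc P [ A ] _)
      (under (P ++ [ A ]) p (subst (_⊢S _) (sym (++-assoc P [ A ] _)) d))
  under P (↭.swap A B p) d =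
    subst (_⊢S _) (++-assoc P (B ∷ A ∷ []) _)
      (under (P ++ B ∷ A ∷ []) p
        (subst (_⊢S _) (sym (++-assoc P (B ∷ A ∷ []) _)) (exch {Γ = P} d)))
  under P (↭.trans p q) d = under P q (under P p d)

cut₁ : ∀ {Γ A B} → Γ ⊢S A → [ A ] ⊢S B → Γ ⊢S B
cut₁ {Γ} d e = subst (_⊢S _) (++-identityʳ Γ) (cut {Δ = []} {Θ = []} d e)

mutual
  ⌜_⌝ᶠ : Factor → Formula
  ⌜ fvar p ⌝ᶠ   = var p
  ⌜ fimp A B ⌝ᶠ = ⌜ A ⌝ ⇒ ⌜ B ⌝

  ⌜_⌝ : AFormula → Formula
  ⌜ [] ⌝    = I
  ⌜ f ∷ G ⌝ = ⌜ f ⌝ᶠ ⊗ ⌜ G ⌝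

⟦_⟧ : AFormula → List Formula
⟦_⟧ = map ⌜_⌝ᶠ

⟦⟧-++ : ∀ G H → ⟦ G ⊗α H ⟧ ≡ ⟦ G ⟧ ++ ⟦ H ⟧
⟦⟧-++ = map-++ ⌜_⌝ᶠ

⟦⟧-++₃ : ∀ G H K → ⟦ G ⊗α H ⊗α K ⟧ ≡ ⟦ G ⟧ ++ ⟦ H ⟧ ++ ⟦ K ⟧
⟦⟧-++₃ G H K = trans (⟦⟧-++ G (H ⊗α K)) (cong (⟦ G ⟧ ++_) (⟦⟧-++ H K))

⟦⟧⊢⌜⌝ : ∀ G → ⟦ G ⟧ ⊢S ⌜ G ⌝
⟦⟧⊢⌜⌝ []      = axI
⟦⟧⊢⌜⌝ (f ∷ G) = ⊗R {Γ = [ ⌜ f ⌝ᶠ ]} ax (⟦⟧⊢⌜⌝ G)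

⊗L⋆ : ∀ Γ G Δ {C} → Γ ++ ⟦ G ⟧ ++ Δ ⊢S C → Γ ++ ⌜ G ⌝ ∷ Δ ⊢S C
⊗L⋆ Γ [] Δ d = ⊢S-resp-↭ (↭-sym (shift I Γ Δ)) (weak d)
⊗L⋆ Γ (f ∷ G) Δ d =
  ⊗L {Γ = Γ} (subst (_⊢S _) (++-assoc Γ [ ⌜ f ⌝ᶠ ] _)
    (⊗L⋆ (Γ ++ [ ⌜ f ⌝ᶠ ]) G Δ (subst (_⊢S _) (sym (++-assoc Γ [ ⌜ f ⌝ᶠ ] _)) d)))

⌜⌝-L : ∀ G {C} → ⟦ G ⟧ ⊢S C → [ ⌜ G ⌝ ] ⊢S C
⌜⌝-L G d = ⊗L⋆ [] G [] (subst (_⊢S _) (sym (++-identityʳ ⟦ G ⟧)) d)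

⌜⌝⊗⌜⌝⊢⌜++⌝ : ∀ G H → [ ⌜ G ⌝ ⊗ ⌜ H ⌝ ] ⊢S ⌜ G ⊗α H ⌝
⌜⌝⊗⌜⌝⊢⌜++⌝ []      H = ⊗L {Γ = []} (weak ax)
⌜⌝⊗⌜⌝⊢⌜++⌝ (f ∷ G) H =
  ⊗L {Γ = []} (⊗L {Γ = []} (⊗R {Γ = [ ⌜ f ⌝ᶠ ]} ax
    (cut₁ (⊗R {Γ = [ ⌜ G ⌝ ]} ax ax) (⌜⌝⊗⌜⌝⊢⌜++⌝ G H))))

⊢IL⇒⊢S : ∀ {G D} → G ⊢IL D → ⟦ G ⟧ ⊢S ⌜ D ⌝
⊢IL⇒⊢S (ax {D}) = ⟦⟧⊢⌜⌝ D
⊢IL⇒⊢S (exch {G} {A} {B} {E} d) = ⊢S-resp-↭ (map⁺ ⌜_⌝ᶠ (++⁺ˡ G (shifts A B))) (⊢IL⇒⊢S d)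
⊢IL⇒⊢S (cut {C} {A} {G} {E} d e) rewrite ⟦⟧-++₃ G C E =
  cut (⊢IL⇒⊢S d) (⊗L⋆ ⟦ G ⟧ A ⟦ E ⟧ (subst (_⊢S _) (⟦⟧-++₃ G A E) (⊢IL⇒⊢S e)))
⊢IL⇒⊢S (⇒L {C} {A} {B} {G} d e) rewrite ⟦⟧-++ C ((A ⇒α B) ⊗α G) =
  ⇒L (⊢IL⇒⊢S d) (⊗L⋆ [] B ⟦ G ⟧ (subst (_⊢S _) (⟦⟧-++ B G) (⊢IL⇒⊢S e)))
⊢IL⇒⊢S (⇒R {A} {G} d) =
  subst (_⊢S _) (++-identityʳ ⟦ G ⟧)
    (⊗R (⇒R (⊗L⋆ [] A ⟦ G ⟧ (subst (_⊢S _) (⟦⟧-++ A G) (⊢IL⇒⊢S d)))) axI)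
⊢IL⇒⊢S (⊗⊗ {A} {B} {C} {E} d e) rewrite ⟦⟧-++ A B =
  cut₁ (⊗R (⊢IL⇒⊢S d) (⊢IL⇒⊢S e)) (⌜⌝⊗⌜⌝⊢⌜++⌝ C E)

mutual
  ⊢⌜*⌝ : ∀ A → [ A ] ⊢S ⌜ A * ⌝
  ⊢⌜*⌝ (var p) = ⊗R {Γ = [ var p ]} ax axI
  ⊢⌜*⌝ I       = weak axI
  ⊢⌜*⌝ (A ⊗ B) = ⊗L {Γ = []} (cut₁ (⊗R {Γ = [ A ]} (⊢⌜*⌝ A) (⊢⌜*⌝ B)) (⌜⌝⊗⌜⌝⊢⌜++⌝ (A *) (B *)))
  ⊢⌜*⌝ (A ⇒ B) = ⊗R {Γ = [ A ⇒ B ]} (⇒R (⇒L {Γ = [ ⌜ A * ⌝ ]} {Δ = []} (⌜*⌝⊢ A) (⊢⌜*⌝ B))) axI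

  ⟦*⟧⊢ : ∀ A → ⟦ A * ⟧ ⊢S A
  ⟦*⟧⊢ (var p) = ax
  ⟦*⟧⊢ I       = axI
  ⟦*⟧⊢ (A ⊗ B) = subst (_⊢S A ⊗ B) (sym (⟦⟧-++ (A *) (B *))) (⊗R (⟦*⟧⊢ A) (⟦*⟧⊢ B))
  ⟦*⟧⊢ (A ⇒ B) = ⇒R (⇒L {Γ = [ A ]} {Δ = []} (⊢⌜*⌝ A) (⌜*⌝⊢ B))

  ⌜*⌝⊢ : ∀ A → [ ⌜ A * ⌝ ] ⊢S A
  ⌜*⌝⊢ A = ⌜⌝-L (A *) (⟦*⟧⊢ A)

⊢⌜*s⌝ : ∀ Γ → Γ ⊢S ⌜ Γ *s ⌝
⊢⌜*s⌝ []      = axI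
⊢⌜*s⌝ (A ∷ Γ) = cut₁ (⊗R {Γ = [ A ]} (⊢⌜*⌝ A) (⊢⌜*s⌝ Γ)) (⌜⌝⊗⌜⌝⊢⌜++⌝ (A *) (Γ *s))

proposition4p1 : (Γ : List Formula) (B : Formula) → (Γ ⊢S B) ⇔ ((Γ *s) ⊢IL (B *))
proposition4p1 Γ B = mk⇔ ⊢S⇒⊢IL ⊢IL⇒⊢S′
  where
  ⊢IL⇒⊢S′ : Γ *s ⊢IL B * → Γ ⊢S B
  ⊢IL⇒⊢S′ d = cut₁ (⊢⌜*s⌝ Γ) (⌜⌝-L (Γ *s) (cut₁ (⊢IL⇒⊢S d) (⌜*⌝⊢ B)))
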